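{- In $\Lambda_{\mathbb{Q}}[[q,t]]$ one has the factorization \[ H(t)=\sum_{n\ge0}h_nt^n=\prod_{k=0}^{\infty}\big(1+(1-q)(q^kt)\,p_q(q^kt)\big)=\prod_{k=0}^{\infty}\Big(1+(1-q)\sum_{n\geq1}[p_n]_q(q^kt)^n\Big), \] where the series and products converge formally.
   Context: $\Lambda_{\mathbb{Q}}$ is the algebra of symmetric functions in $x_1,x_2,\dots$ over $\mathbb{Q}$, $e_n,h_n$ the elementary and complete homogeneous symmetric functions ($e_0=h_0=1$), $E(t)=\sum e_nt^n$, $H(t)=\sum h_nt^n$. $q$ is an indeterminate, $[n]_q=1+\cdots+q^{n-1}$, $D_qF(t)=\frac{F(qt)-F(t)}{(q-1)t}$. The $q$-power sums $[p_n]_q$ ($n\ge1$) are defined by $\sum_{n\geq1}[p_n]_q(-t)^{n-1}=D_qE(t)/E(t)$; each is a polynomial in $q$ with coefficients in $\Lambda_{\mathbb{Q}}$. Set $p_q(t)=\sum_{n\ge0}[p_{n+1}]_qt^n$. Formal convergence refers to the $(q,t)$-adic topology. -}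

module Defs where

open import Data.Nat using (ℕ; zero; suc; _∸_; _*_; _≤ᵇ_; _≡ᵇ_)
open import Data.Rational using (ℚ; 0ℚ; 1ℚ; _+_; -_) renaming (_*_ to _·_)
open import Data.List using (List; []; _∷_; [_]; map; concatMap; upTo; foldr)
open import Data.Bool.ListAction using (all)
open import Data.Nat.ListAction using (sum)
open import Data.Bool using (Bool; true; false; if_then_else_; _∧_)
open import Data.Product using (_×_; _,_)

-- Elements of Λ_ℚ[[q,t]] are represented inside ℚ[[x₁,x₂,…]][[q,t]]
-- (Λ_ℚ embeds in ℚ[[x₁,x₂,…]]) by their coefficient function:
--   F a b m = coefficient of  q^a t^b x^m ,
-- where the x-monomial x^m = x₁^{m₀} x₂^{m₁} … is given by a finite
-- exponent list m (trailing zeros allowed).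

PS : Set
PS = ℕ → ℕ → List ℕ → ℚ

Σ≤ : ℕ → (ℕ → ℚ) → ℚ
Σ≤ zero f = f 0
Σ≤ (suc n) f = Σ≤ n f + f (suc n)

sumL : List ℚ → ℚ
sumL = foldr _+_ 0ℚ

splits : List ℕ → List (List ℕ × List ℕ)
splits [] = [ ([] , []) ]
splits (c ∷ m) =
  concatMap (λ i → map (λ uv → (i ∷ Data.Product.proj₁ uv , (c ∸ i) ∷ Data.Product.proj₂ uv)) (splits m))
            (upTo (suc c))

_⊕_ : PS → PS → PS
(f ⊕ g) a b m = f a b m + g a b m

_⊛_ : PS → PS → PS
(f ⊛ g) a b m =
  Σ≤ a λ i → Σ≤ b λ j →
    sumL (map (λ uv → f i j (Data.Product.proj₁ uv) · g (a ∸ i) (b ∸ j) (Data.Product.proj₂ uv)) (splits m))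

isZeroMono : List ℕ → Bool
isZeroMono = all (λ c → c ≡ᵇ 0)

one : PS
one a b m = if (a ≡ᵇ 0) ∧ (b ≡ᵇ 0) ∧ isZeroMono m then 1ℚ else 0ℚ

eCoeff : ℕ → List ℕ → ℚ
eCoeff n m = if all (λ c → c ≤ᵇ 1) m ∧ (sum m ≡ᵇ n) then 1ℚ else 0ℚ

hCoeff : ℕ → List ℕ → ℚ
hCoeff n m = if sum m ≡ᵇ n then 1ℚ else 0ℚ

E : PS
E a b m = if a ≡ᵇ 0 then eCoeff b m else 0ℚ

H : PS
H a b m = if a ≡ᵇ 0 then hCoeff b m else 0ℚ

-- D_q F(t) = (F(qt) - F(t)) / ((q-1) t) = Σ_{n≥1} f_n [n]_q t^{n-1}
-- coefficient of q^a t^b :  Σ_{j=0}^{min(a,b)} [q^{a-j} t^{b+1}] F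
Dq : PS → PS
Dq F a b m = Σ≤ b (λ j → if j ≤ᵇ a then F (a ∸ j) (suc b) m else 0ℚ)

sgn : ℕ → ℚ → ℚ
sgn zero x = x
sgn (suc n) x = - (sgn n x)

negT : PS → PS
negT F a b m = sgn b (F a b m)

-- F(t) ↦ (q^k t) · F(q^k t)
qkt : ℕ → PS → PS
qkt k F a zero m = 0ℚ
qkt k F a (suc b) m = if (k * suc b) ≤ᵇ a then F (a ∸ (k * suc b)) b m else 0ℚ

oneMinusQ : PS → PS
oneMinusQ F zero b m = F zero b m
oneMinusQ F (suc a) b m = F (suc a) b m + - (F a b m)

factor : PS → ℕ → PS
factor pq k = one ⊕ oneMinusQ (qkt k pq)

partialProd : PS → ℕ → PS
partialProd pq zero = one
partialProd pq (suc K) = partialProd pq K ⊛ factor pq K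

-- Since E(-t) H(t) = 1, the hypothesis p_q(-t) E(t) = D_q E(t) gives p_q(t) = D_q E(-t) H(t).
-- As (1 - q) [n]_q = 1 - q^n, also (1 - q) t D_q E(-t) = E(-qt) - E(-t), whence
--   (1 + (1 - q) t p_q(t)) H(qt) = H(qt) + (E(-qt) - E(-t)) H(t) H(qt) = H(t).
-- Substituting t ↦ q^k t and telescoping, (∏_{k<K} factor k) · H(q^K t) = H(t); since
-- H(q^K t) ≡ 1 modulo q^K, the partial product agrees with H in every q-degree below K.
module Submission where

open import Defs
open import Data.Nat using (ℕ; _≤_)
open import Data.List using (List)
open import Data.Product using (∃-syntax)
open import Relation.Binary.PropositionalEquality using (_≡_)

open import Algebra.Bundles using (CommutativeMonoid)
open import Data.Bool using (Bool; true; false; if_then_else_; _∧_)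
open import Data.Bool.ListAction using (all)
open import Data.List using ([]; _∷_; _++_; map; concat; concatMap; upTo; applyUpTo)
import Data.List.Properties as List
open import Data.Nat using (zero; suc; _<_; _∸_; _≤ᵇ_; _≡ᵇ_; z≤n; s≤s) renaming (_+_ to _+ℕ_; _*_ to _*ℕ_)
open import Data.Nat.ListAction using (sum)
import Data.Nat.Properties as ℕ
open import Data.Product using (_×_; _,_; proj₁; proj₂)
open import Data.Rational using (ℚ; 0ℚ; 1ℚ; _+_; -_) renaming (_*_ to _·_)
import Data.Rational.Properties as ℚ
open import Relation.Binary.PropositionalEquality using (refl; sym; trans; cong; cong₂; _≗_; module ≡-Reasoning)
open import Algebra.Properties.CommutativeSemigroup
  (CommutativeMonoid.commutativeSemigroup ℚ.+-0-commutativeMonoid) using (interchange)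
open import Algebra.Properties.Group ℚ.+-0-group using () renaming (⁻¹-involutive to neg-involutive)
open ≡-Reasoning

Σ≤-cong : ∀ n {f g : ℕ → ℚ} → (∀ i → f i ≡ g i) → Σ≤ n f ≡ Σ≤ n g
Σ≤-cong zero e = e 0
Σ≤-cong (suc n) e = cong₂ _+_ (Σ≤-cong n e) (e (suc n))

Σ≤-cong-≤ : ∀ n {f g : ℕ → ℚ} → (∀ i → i ≤ n → f i ≡ g i) → Σ≤ n f ≡ Σ≤ n g
Σ≤-cong-≤ zero e = e 0 z≤n
Σ≤-cong-≤ (suc n) e = cong₂ _+_ (Σ≤-cong-≤ n (λ i i≤n → e i (ℕ.m≤n⇒m≤1+n i≤n))) (e (suc n) ℕ.≤-refl)

Σ≤-distrib-+ : ∀ n (f g : ℕ → ℚ) → Σ≤ n (λ i → f i + g i) ≡ Σ≤ n f + Σ≤ n g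
Σ≤-distrib-+ zero f g = refl
Σ≤-distrib-+ (suc n) f g =
  trans (cong (_+ (f (suc n) + g (suc n))) (Σ≤-distrib-+ n f g)) (interchange (Σ≤ n f) (Σ≤ n g) (f (suc n)) (g (suc n)))

Σ≤-neg : ∀ n (f : ℕ → ℚ) → Σ≤ n (λ i → - f i) ≡ - Σ≤ n f
Σ≤-neg zero f = refl
Σ≤-neg (suc n) f = trans (cong (_+ (- f (suc n))) (Σ≤-neg n f)) (sym (ℚ.neg-distrib-+ (Σ≤ n f) (f (suc n))))

Σ≤-zero : ∀ n {f : ℕ → ℚ} → (∀ i → f i ≡ 0ℚ) → Σ≤ n f ≡ 0ℚ
Σ≤-zero zero e = e 0
Σ≤-zero (suc n) e = trans (cong₂ _+_ (Σ≤-zero n e) (e (suc n))) (ℚ.+-identityʳ 0ℚ)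

Σ≤-suc-head : ∀ n (f : ℕ → ℚ) → Σ≤ (suc n) f ≡ f 0 + Σ≤ n (λ i → f (suc i))
Σ≤-suc-head zero f = refl
Σ≤-suc-head (suc n) f = trans (cong (_+ f (suc (suc n))) (Σ≤-suc-head n f)) (ℚ.+-assoc (f 0) _ _)

Σ≤-comm : ∀ n m (f : ℕ → ℕ → ℚ) → Σ≤ n (λ i → Σ≤ m (f i)) ≡ Σ≤ m (λ j → Σ≤ n (λ i → f i j))
Σ≤-comm zero m f = refl
Σ≤-comm (suc n) m f =
  trans (cong (_+ Σ≤ m (f (suc n))) (Σ≤-comm n m f)) (sym (Σ≤-distrib-+ m _ (f (suc n))))

Σ≤-reverse : ∀ n (f : ℕ → ℚ) → Σ≤ n f ≡ Σ≤ n (λ i → f (n ∸ i))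
Σ≤-reverse zero f = refl
Σ≤-reverse (suc n) f = begin
  Σ≤ n f + f (suc n)                 ≡⟨ cong (_+ f (suc n)) (Σ≤-reverse n f) ⟩
  Σ≤ n (λ i → f (n ∸ i)) + f (suc n) ≡⟨ ℚ.+-comm _ (f (suc n)) ⟩
  f (suc n) + Σ≤ n (λ i → f (n ∸ i)) ≡⟨ Σ≤-suc-head n (λ i → f (suc n ∸ i)) ⟨
  Σ≤ (suc n) (λ i → f (suc n ∸ i))   ∎

Σ≤-reverse-∸ : ∀ n (f : ℕ → ℕ → ℚ) → Σ≤ n (λ i → f i (n ∸ i)) ≡ Σ≤ n (λ i → f (n ∸ i) i)
Σ≤-reverse-∸ n f =
  trans (Σ≤-reverse n _) (Σ≤-cong-≤ n (λ i i≤n → cong (f (n ∸ i)) (ℕ.m∸[m∸n]≡n i≤n)))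

Σ≤-triangle : ∀ n (f : ℕ → ℕ → ℚ) →
  Σ≤ n (λ i → Σ≤ i (λ j → f j i)) ≡ Σ≤ n (λ j → Σ≤ (n ∸ j) (λ k → f j (j +ℕ k)))
Σ≤-triangle zero f = refl
Σ≤-triangle (suc n) f = begin
  Σ≤ n (λ i → Σ≤ i (λ j → f j i)) + Σ≤ (suc n) (λ j → f j (suc n))
    ≡⟨ cong (_+ Σ≤ (suc n) (λ j → f j (suc n))) (Σ≤-triangle n f) ⟩
  Σ≤ n (λ j → Σ≤ (n ∸ j) (λ k → f j (j +ℕ k))) + (Σ≤ n (λ j → f j (suc n)) + f (suc n) (suc n))
    ≡⟨ ℚ.+-assoc (Σ≤ n (λ j → Σ≤ (n ∸ j) (λ k → f j (j +ℕ k)))) _ _ ⟨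
  (Σ≤ n (λ j → Σ≤ (n ∸ j) (λ k → f j (j +ℕ k))) + Σ≤ n (λ j → f j (suc n))) + f (suc n) (suc n)
    ≡⟨ cong₂ _+_ (trans (sym (Σ≤-distrib-+ n _ _)) (Σ≤-cong-≤ n grow-row)) last-row ⟩
  Σ≤ n (λ j → Σ≤ (suc n ∸ j) (λ k → f j (j +ℕ k))) + Σ≤ (suc n ∸ suc n) (λ k → f (suc n) (suc n +ℕ k)) ∎
  where
  grow-row : ∀ j → j ≤ n →
    Σ≤ (n ∸ j) (λ k → f j (j +ℕ k)) + f j (suc n) ≡ Σ≤ (suc n ∸ j) (λ k → f j (j +ℕ k))
  grow-row j j≤n rewrite ℕ.+-∸-assoc 1 j≤n =
    cong (λ r → Σ≤ (n ∸ j) (λ k → f j (j +ℕ k)) + f j r) (sym (trans (ℕ.+-suc j (n ∸ j)) (cong suc (ℕ.m+[n∸m]≡n j≤n))))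
  last-row : f (suc n) (suc n) ≡ Σ≤ (suc n ∸ suc n) (λ k → f (suc n) (suc n +ℕ k))
  last-row rewrite ℕ.n∸n≡0 n | ℕ.+-identityʳ n = refl

when : Bool → ℚ → ℚ
when true x = x
when false x = 0ℚ

if-then-0≡when : ∀ b x → (if b then x else 0ℚ) ≡ when b x
if-then-0≡when true x = refl
if-then-0≡when false x = refl

when-0 : ∀ b → when b 0ℚ ≡ 0ℚ
when-0 true = refl
when-0 false = refl

when-+ : ∀ b x y → when b (x + y) ≡ when b x + when b y
when-+ true x y = refl
when-+ false x y = refl

when-neg : ∀ b x → - when b x ≡ when b (- x)
when-neg true x = refl
when-neg false x = refl

Σ≤-when : ∀ n b (f : ℕ → ℚ) → Σ≤ n (λ i → when b (f i)) ≡ when b (Σ≤ n f)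
Σ≤-when n true f = refl
Σ≤-when n false f = Σ≤-zero n (λ _ → refl)

suc≤ᵇsuc : ∀ m n → (suc m ≤ᵇ suc n) ≡ (m ≤ᵇ n)
suc≤ᵇsuc zero n = refl
suc≤ᵇsuc (suc m) n = refl

when-≤ᵇ-∸ : ∀ c d a x → when (c ≤ᵇ a) (when (d ≤ᵇ (a ∸ c)) x) ≡ when ((c +ℕ d) ≤ᵇ a) x
when-≤ᵇ-∸ zero d a x = refl
when-≤ᵇ-∸ (suc c) d zero x = refl
when-≤ᵇ-∸ (suc c) d (suc a) x rewrite suc≤ᵇsuc c a | suc≤ᵇsuc (c +ℕ d) a = when-≤ᵇ-∸ c d a x

Σ≤-from : ∀ n c (f : ℕ → ℚ) → Σ≤ n (λ i → when (c ≤ᵇ i) (f i)) ≡ when (c ≤ᵇ n) (Σ≤ (n ∸ c) (λ i → f (c +ℕ i)))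
Σ≤-from n zero f = refl
Σ≤-from zero (suc c) f = refl
Σ≤-from (suc n) (suc c) f = begin
  Σ≤ (suc n) (λ i → when (suc c ≤ᵇ i) (f i))
    ≡⟨ trans (Σ≤-suc-head n _) (ℚ.+-identityˡ _) ⟩
  Σ≤ n (λ i → when (suc c ≤ᵇ suc i) (f (suc i)))
    ≡⟨ Σ≤-cong n (λ i → cong (λ b → when b (f (suc i))) (suc≤ᵇsuc c i)) ⟩
  Σ≤ n (λ i → when (c ≤ᵇ i) (f (suc i)))
    ≡⟨ Σ≤-from n c (λ i → f (suc i)) ⟩
  when (c ≤ᵇ n) (Σ≤ (n ∸ c) (λ i → f (suc (c +ℕ i))))
    ≡⟨ cong (λ b → when b (Σ≤ (n ∸ c) (λ i → f (suc (c +ℕ i))))) (suc≤ᵇsuc c n) ⟨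
  when (suc c ≤ᵇ suc n) (Σ≤ (n ∸ c) (λ i → f (suc (c +ℕ i)))) ∎

Σ≤-upto-∸ : ∀ n d (f : ℕ → ℕ → ℚ) →
  Σ≤ n (λ i → when (d ≤ᵇ (n ∸ i)) (f i ((n ∸ i) ∸ d))) ≡ when (d ≤ᵇ n) (Σ≤ (n ∸ d) (λ i → f i ((n ∸ d) ∸ i)))
Σ≤-upto-∸ n d f = begin
  Σ≤ n (λ i → when (d ≤ᵇ (n ∸ i)) (f i ((n ∸ i) ∸ d)))
    ≡⟨ Σ≤-reverse-∸ n (λ i j → when (d ≤ᵇ j) (f i (j ∸ d))) ⟩
  Σ≤ n (λ i → when (d ≤ᵇ i) (f (n ∸ i) (i ∸ d)))
    ≡⟨ Σ≤-from n d _ ⟩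
  when (d ≤ᵇ n) (Σ≤ (n ∸ d) (λ i → f (n ∸ (d +ℕ i)) ((d +ℕ i) ∸ d)))
    ≡⟨ cong (when (d ≤ᵇ n)) (Σ≤-cong (n ∸ d) (λ i → cong₂ f (sym (ℕ.∸-+-assoc n d i)) (ℕ.m+n∸m≡n d i))) ⟩
  when (d ≤ᵇ n) (Σ≤ (n ∸ d) (λ i → f ((n ∸ d) ∸ i) i))
    ≡⟨ cong (when (d ≤ᵇ n)) (Σ≤-reverse-∸ (n ∸ d) f) ⟨
  when (d ≤ᵇ n) (Σ≤ (n ∸ d) (λ i → f i ((n ∸ d) ∸ i))) ∎

-- The coefficient form of (q^c F) (q^d G) = q^(c+d) (F G).
Σ≤-shifted-convolution : ∀ n c d (f : ℕ → ℕ → ℚ) →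
  Σ≤ n (λ i → when (c ≤ᵇ i) (when (d ≤ᵇ (n ∸ i)) (f (i ∸ c) ((n ∸ i) ∸ d))))
  ≡ when ((c +ℕ d) ≤ᵇ n) (Σ≤ (n ∸ (c +ℕ d)) (λ i → f i ((n ∸ (c +ℕ d)) ∸ i)))
Σ≤-shifted-convolution n c d f = begin
  Σ≤ n (λ i → when (c ≤ᵇ i) (when (d ≤ᵇ (n ∸ i)) (f (i ∸ c) ((n ∸ i) ∸ d))))
    ≡⟨ Σ≤-from n c _ ⟩
  when (c ≤ᵇ n) (Σ≤ (n ∸ c) (λ i → when (d ≤ᵇ (n ∸ (c +ℕ i))) (f ((c +ℕ i) ∸ c) ((n ∸ (c +ℕ i)) ∸ d))))
    ≡⟨ cong (when (c ≤ᵇ n)) (Σ≤-cong (n ∸ c) (λ i → cong₂ (λ k r → when (d ≤ᵇ k) (f r (k ∸ d)))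
          (sym (ℕ.∸-+-assoc n c i)) (ℕ.m+n∸m≡n c i))) ⟩
  when (c ≤ᵇ n) (Σ≤ (n ∸ c) (λ i → when (d ≤ᵇ ((n ∸ c) ∸ i)) (f i (((n ∸ c) ∸ i) ∸ d))))
    ≡⟨ cong (when (c ≤ᵇ n)) (Σ≤-upto-∸ (n ∸ c) d f) ⟩
  when (c ≤ᵇ n) (when (d ≤ᵇ (n ∸ c)) (Σ≤ ((n ∸ c) ∸ d) (λ i → f i (((n ∸ c) ∸ d) ∸ i))))
    ≡⟨ when-≤ᵇ-∸ c d n _ ⟩
  when ((c +ℕ d) ≤ᵇ n) (Σ≤ ((n ∸ c) ∸ d) (λ i → f i (((n ∸ c) ∸ d) ∸ i)))
    ≡⟨ cong (λ k → when ((c +ℕ d) ≤ᵇ n) (Σ≤ k (λ i → f i (k ∸ i)))) (ℕ.∸-+-assoc n c d) ⟩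
  when ((c +ℕ d) ≤ᵇ n) (Σ≤ (n ∸ (c +ℕ d)) (λ i → f i ((n ∸ (c +ℕ d)) ∸ i))) ∎

sgn-0 : ∀ n → sgn n 0ℚ ≡ 0ℚ
sgn-0 zero = refl
sgn-0 (suc n) = cong -_ (sgn-0 n)

sgn-+ : ∀ n x y → sgn n (x + y) ≡ sgn n x + sgn n y
sgn-+ zero x y = refl
sgn-+ (suc n) x y = trans (cong -_ (sgn-+ n x y)) (ℚ.neg-distrib-+ (sgn n x) (sgn n y))

sgn-neg : ∀ n x → sgn n (- x) ≡ - sgn n x
sgn-neg zero x = refl
sgn-neg (suc n) x = cong -_ (sgn-neg n x)

sgn-involutive : ∀ n x → sgn n (sgn n x) ≡ x
sgn-involutive zero x = refl
sgn-involutive (suc n) x = trans (cong -_ (sgn-neg n (sgn n x))) (trans (neg-involutive _) (sgn-involutive n x))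

sgn-+ℕ : ∀ j k x → sgn (j +ℕ k) x ≡ sgn j (sgn k x)
sgn-+ℕ zero k x = refl
sgn-+ℕ (suc j) k x = cong -_ (sgn-+ℕ j k x)

Σ≤-sgn : ∀ n m (f : ℕ → ℚ) → Σ≤ m (λ i → sgn n (f i)) ≡ sgn n (Σ≤ m f)
Σ≤-sgn zero m f = refl
Σ≤-sgn (suc n) m f = trans (Σ≤-neg m _) (cong -_ (Σ≤-sgn n m f))

sgn-when : ∀ n b x → sgn n (when b x) ≡ when b (sgn n x)
sgn-when n true x = refl
sgn-when n false x = sgn-0 n

-- Power series in x₀, x₁, …, given by the coefficient of x₀^l₀ x₁^l₁ ⋯ for each exponent list l.

Series : Set
Series = List ℕ → ℚ

slice : Series → ℕ → Series
slice F i u = F (i ∷ u)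

infixl 7 _⋆_
_⋆_ : Series → Series → Series
(F ⋆ G) [] = F [] · G []
(F ⋆ G) (c ∷ l) = Σ≤ c λ i → (slice F i ⋆ slice G (c ∸ i)) l

𝟙 : Series
𝟙 l = if isZeroMono l then 1ℚ else 0ℚ

infixl 6 _+ₛ_ _-ₛ_
_+ₛ_ _-ₛ_ : Series → Series → Series
(F +ₛ G) l = F l + G l
(F -ₛ G) l = F l + - G l

⋆-cong : ∀ {F F' G G'} → F ≗ F' → G ≗ G' → F ⋆ G ≗ F' ⋆ G'
⋆-cong eF eG [] = cong₂ _·_ (eF []) (eG [])
⋆-cong eF eG (c ∷ l) = Σ≤-cong c (λ i → ⋆-cong (λ u → eF (i ∷ u)) (λ v → eG ((c ∸ i) ∷ v)) l)

⋆-congˡ : ∀ {F F'} G → F ≗ F' → F ⋆ G ≗ F' ⋆ G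
⋆-congˡ G eF = ⋆-cong eF (λ _ → refl)

⋆-congʳ : ∀ F {G G'} → G ≗ G' → F ⋆ G ≗ F ⋆ G'
⋆-congʳ F eG = ⋆-cong (λ _ → refl) eG

⋆-zeroˡ : ∀ G l → ((λ _ → 0ℚ) ⋆ G) l ≡ 0ℚ
⋆-zeroˡ G [] = ℚ.*-zeroˡ (G [])
⋆-zeroˡ G (c ∷ l) = Σ≤-zero c (λ i → ⋆-zeroˡ _ l)

⋆-zeroʳ : ∀ F l → (F ⋆ (λ _ → 0ℚ)) l ≡ 0ℚ
⋆-zeroʳ F [] = ℚ.*-zeroʳ (F [])
⋆-zeroʳ F (c ∷ l) = Σ≤-zero c (λ i → ⋆-zeroʳ _ l)

⋆-distribʳ-+ : ∀ F F' G → (F +ₛ F') ⋆ G ≗ F ⋆ G +ₛ F' ⋆ G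
⋆-distribʳ-+ F F' G [] = ℚ.*-distribʳ-+ (G []) (F []) (F' [])
⋆-distribʳ-+ F F' G (c ∷ l) =
  trans (Σ≤-cong c (λ i → ⋆-distribʳ-+ (slice F i) (slice F' i) (slice G (c ∸ i)) l)) (Σ≤-distrib-+ c _ _)

⋆-distribˡ-+ : ∀ F G G' → F ⋆ (G +ₛ G') ≗ F ⋆ G +ₛ F ⋆ G'
⋆-distribˡ-+ F G G' [] = ℚ.*-distribˡ-+ (F []) (G []) (G' [])
⋆-distribˡ-+ F G G' (c ∷ l) =
  trans (Σ≤-cong c (λ i → ⋆-distribˡ-+ (slice F i) (slice G (c ∸ i)) (slice G' (c ∸ i)) l)) (Σ≤-distrib-+ c _ _)

⋆-distribʳ-Σ≤ : ∀ n (F : ℕ → Series) G l → ((λ u → Σ≤ n (λ k → F k u)) ⋆ G) l ≡ Σ≤ n (λ k → (F k ⋆ G) l)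
⋆-distribʳ-Σ≤ zero F G l = refl
⋆-distribʳ-Σ≤ (suc n) F G l =
  trans (⋆-distribʳ-+ _ _ G l) (cong (_+ (F (suc n) ⋆ G) l) (⋆-distribʳ-Σ≤ n F G l))

⋆-distribˡ-Σ≤ : ∀ n F (G : ℕ → Series) l → (F ⋆ (λ u → Σ≤ n (λ k → G k u))) l ≡ Σ≤ n (λ k → (F ⋆ G k) l)
⋆-distribˡ-Σ≤ zero F G l = refl
⋆-distribˡ-Σ≤ (suc n) F G l =
  trans (⋆-distribˡ-+ F _ _ l) (cong (_+ (F ⋆ G (suc n)) l) (⋆-distribˡ-Σ≤ n F G l))

⋆-negˡ : ∀ F G l → ((λ u → - F u) ⋆ G) l ≡ - (F ⋆ G) l
⋆-negˡ F G [] = sym (ℚ.neg-distribˡ-* (F []) (G []))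
⋆-negˡ F G (c ∷ l) = trans (Σ≤-cong c (λ i → ⋆-negˡ _ _ l)) (Σ≤-neg c _)

⋆-negʳ : ∀ F G l → (F ⋆ (λ u → - G u)) l ≡ - (F ⋆ G) l
⋆-negʳ F G [] = sym (ℚ.neg-distribʳ-* (F []) (G []))
⋆-negʳ F G (c ∷ l) = trans (Σ≤-cong c (λ i → ⋆-negʳ _ _ l)) (Σ≤-neg c _)

⋆-distribʳ-sub : ∀ F F' G → (F -ₛ F') ⋆ G ≗ F ⋆ G -ₛ F' ⋆ G
⋆-distribʳ-sub F F' G l = trans (⋆-distribʳ-+ F (λ u → - F' u) G l) (cong ((F ⋆ G) l +_) (⋆-negˡ F' G l))

⋆-whenˡ : ∀ b F G l → ((λ u → when b (F u)) ⋆ G) l ≡ when b ((F ⋆ G) l)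
⋆-whenˡ true F G l = refl
⋆-whenˡ false F G l = ⋆-zeroˡ G l

⋆-whenʳ : ∀ b F G l → (F ⋆ (λ u → when b (G u))) l ≡ when b ((F ⋆ G) l)
⋆-whenʳ true F G l = refl
⋆-whenʳ false F G l = ⋆-zeroʳ F l

⋆-whenˡʳ : ∀ b b' F G l → ((λ u → when b (F u)) ⋆ (λ v → when b' (G v))) l ≡ when b (when b' ((F ⋆ G) l))
⋆-whenˡʳ b b' F G l = trans (⋆-whenˡ b F _ l) (cong (when b) (⋆-whenʳ b' F G l))

⋆-sgnˡ : ∀ n F G l → ((λ u → sgn n (F u)) ⋆ G) l ≡ sgn n ((F ⋆ G) l)
⋆-sgnˡ zero F G l = refl
⋆-sgnˡ (suc n) F G l = trans (⋆-negˡ _ G l) (cong -_ (⋆-sgnˡ n F G l))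

⋆-sgnʳ : ∀ n F G l → (F ⋆ (λ u → sgn n (G u))) l ≡ sgn n ((F ⋆ G) l)
⋆-sgnʳ zero F G l = refl
⋆-sgnʳ (suc n) F G l = trans (⋆-negʳ F _ l) (cong -_ (⋆-sgnʳ n F G l))

⋆-comm : ∀ F G → F ⋆ G ≗ G ⋆ F
⋆-comm F G [] = ℚ.*-comm (F []) (G [])
⋆-comm F G (c ∷ l) =
  trans (Σ≤-cong c (λ i → ⋆-comm (slice F i) (slice G (c ∸ i)) l))
        (Σ≤-reverse-∸ c (λ i j → (slice G j ⋆ slice F i) l))

⋆-assoc : ∀ F G K → (F ⋆ G) ⋆ K ≗ F ⋆ (G ⋆ K)
⋆-assoc F G K [] = ℚ.*-assoc (F []) (G []) (K [])
⋆-assoc F G K (c ∷ l) = begin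
  Σ≤ c (λ i → ((λ u → Σ≤ i (λ j → (slice F j ⋆ slice G (i ∸ j)) u)) ⋆ slice K (c ∸ i)) l)
    ≡⟨ Σ≤-cong c (λ i → trans (⋆-distribʳ-Σ≤ i _ _ l) (Σ≤-cong i (λ j → ⋆-assoc _ _ _ l))) ⟩
  Σ≤ c (λ i → Σ≤ i (λ j → term j (i ∸ j) (c ∸ i)))
    ≡⟨ Σ≤-triangle c (λ j i → term j (i ∸ j) (c ∸ i)) ⟩
  Σ≤ c (λ j → Σ≤ (c ∸ j) (λ k → term j ((j +ℕ k) ∸ j) (c ∸ (j +ℕ k))))
    ≡⟨ Σ≤-cong c (λ j → Σ≤-cong (c ∸ j) (λ k → cong₂ (term j) (ℕ.m+n∸m≡n j k) (sym (ℕ.∸-+-assoc c j k)))) ⟩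
  Σ≤ c (λ j → Σ≤ (c ∸ j) (λ k → term j k ((c ∸ j) ∸ k)))
    ≡⟨ Σ≤-cong c (λ j → ⋆-distribˡ-Σ≤ (c ∸ j) _ _ l) ⟨
  Σ≤ c (λ j → (slice F j ⋆ (λ v → Σ≤ (c ∸ j) (λ k → (slice G k ⋆ slice K ((c ∸ j) ∸ k)) v))) l) ∎
  where
  term : ℕ → ℕ → ℕ → ℚ
  term j k r = (slice F j ⋆ (slice G k ⋆ slice K r)) l

⋆-identityˡ : ∀ F → 𝟙 ⋆ F ≗ F
⋆-identityˡ F [] = ℚ.*-identityˡ (F [])
⋆-identityˡ F (zero ∷ l) = ⋆-identityˡ (slice F 0) l
⋆-identityˡ F (suc c ∷ l) = begin
  Σ≤ (suc c) (λ i → (slice 𝟙 i ⋆ slice F (suc c ∸ i)) l)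
    ≡⟨ Σ≤-suc-head c _ ⟩
  (𝟙 ⋆ slice F (suc c)) l + Σ≤ c (λ i → ((λ _ → 0ℚ) ⋆ slice F (c ∸ i)) l)
    ≡⟨ cong₂ _+_ (⋆-identityˡ _ l) (Σ≤-zero c (λ i → ⋆-zeroˡ _ l)) ⟩
  F (suc c ∷ l) + 0ℚ
    ≡⟨ ℚ.+-identityʳ _ ⟩
  F (suc c ∷ l) ∎

⋆-identityʳ : ∀ F → F ⋆ 𝟙 ≗ F
⋆-identityʳ F l = trans (⋆-comm F 𝟙 l) (⋆-identityˡ F l)

-- Elements of Λ_ℚ[[q,t]] as series, with q = x₀, t = x₁ and the x-variables shifted by two

asSeries : PS → Series
asSeries A [] = A 0 0 []
asSeries A (a ∷ []) = A a 0 []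
asSeries A (a ∷ b ∷ m) = A a b m

asSeries-cong : ∀ {A B} → (∀ a b m → A a b m ≡ B a b m) → asSeries A ≗ asSeries B
asSeries-cong e [] = e 0 0 []
asSeries-cong e (a ∷ []) = e a 0 []
asSeries-cong e (a ∷ b ∷ m) = e a b m

sumL-++ : ∀ xs ys → sumL (xs ++ ys) ≡ sumL xs + sumL ys
sumL-++ [] ys = sym (ℚ.+-identityˡ _)
sumL-++ (x ∷ xs) ys = trans (cong (x +_) (sumL-++ xs ys)) (sym (ℚ.+-assoc x _ _))

sumL-concat : ∀ xss → sumL (concat xss) ≡ sumL (map sumL xss)
sumL-concat [] = refl
sumL-concat (xs ∷ xss) = trans (sumL-++ xs (concat xss)) (cong (sumL xs +_) (sumL-concat xss))

sumL-applyUpTo : ∀ n f → sumL (applyUpTo f (suc n)) ≡ Σ≤ n f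
sumL-applyUpTo zero f = ℚ.+-identityʳ _
sumL-applyUpTo (suc n) f = trans (cong (f 0 +_) (sumL-applyUpTo n (λ i → f (suc i)))) (sym (Σ≤-suc-head n f))

sumL-splits : ∀ F G m → sumL (map (λ uv → F (proj₁ uv) · G (proj₂ uv)) (splits m)) ≡ (F ⋆ G) m
sumL-splits F G [] = ℚ.+-identityʳ _
sumL-splits F G (c ∷ m) = begin
  sumL (map term (concatMap split-at (upTo (suc c))))
    ≡⟨ cong sumL (List.map-concatMap term split-at (upTo (suc c))) ⟩
  sumL (concat (map (λ i → map term (split-at i)) (upTo (suc c))))
    ≡⟨ sumL-concat (map (λ i → map term (split-at i)) (upTo (suc c))) ⟩
  sumL (map sumL (map (λ i → map term (split-at i)) (upTo (suc c))))
    ≡⟨ cong sumL (List.map-∘ {g = sumL} {f = λ i → map term (split-at i)} (upTo (suc c))) ⟨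
  sumL (map (λ i → sumL (map term (split-at i))) (upTo (suc c)))
    ≡⟨ cong sumL (List.map-applyUpTo (λ i → i) (λ i → sumL (map term (split-at i))) (suc c)) ⟩
  sumL (applyUpTo (λ i → sumL (map term (split-at i))) (suc c))
    ≡⟨ sumL-applyUpTo c _ ⟩
  Σ≤ c (λ i → sumL (map term (split-at i)))
    ≡⟨ Σ≤-cong c (λ i → trans (cong sumL (sym (List.map-∘ {g = term} (splits m)))) (sumL-splits (slice F i) (slice G (c ∸ i)) m)) ⟩
  Σ≤ c (λ i → (slice F i ⋆ slice G (c ∸ i)) m) ∎
  where
  term : List ℕ × List ℕ → ℚ
  term uv = F (proj₁ uv) · G (proj₂ uv)
  split-at : ℕ → List (List ℕ × List ℕ)
  split-at i = map (λ uv → (i ∷ proj₁ uv , (c ∸ i) ∷ proj₂ uv)) (splits m)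

asSeries-⊛ : ∀ A B → asSeries (A ⊛ B) ≗ asSeries A ⋆ asSeries B
asSeries-⊛ A B [] = ℚ.+-identityʳ _
asSeries-⊛ A B (c ∷ []) = Σ≤-cong c (λ i → ℚ.+-identityʳ _)
asSeries-⊛ A B (a ∷ b ∷ m) = Σ≤-cong a (λ i → Σ≤-cong b (λ j → sumL-splits _ _ m))

asSeries-one : asSeries one ≗ 𝟙
asSeries-one [] = refl
asSeries-one (a ∷ []) = refl
asSeries-one (a ∷ b ∷ m) = refl

negVar₀ : Series → Series
negVar₀ F [] = F []
negVar₀ F (a ∷ l) = sgn a (F (a ∷ l))

negVar₁ : Series → Series
negVar₁ F [] = F []
negVar₁ F (a ∷ l) = negVar₀ (slice F a) l

negVar₀-⋆ : ∀ F G → negVar₀ F ⋆ negVar₀ G ≗ negVar₀ (F ⋆ G)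
negVar₀-⋆ F G [] = refl
negVar₀-⋆ F G (b ∷ m) = begin
  Σ≤ b (λ j → ((λ u → sgn j (F (j ∷ u))) ⋆ (λ v → sgn (b ∸ j) (G ((b ∸ j) ∷ v)))) m)
    ≡⟨ Σ≤-cong-≤ b (λ j j≤b → trans (⋆-sgnˡ j _ _ m) (trans (cong (sgn j) (⋆-sgnʳ (b ∸ j) _ _ m))
         (trans (sym (sgn-+ℕ j (b ∸ j) _)) (cong (λ n → sgn n ((slice F j ⋆ slice G (b ∸ j)) m)) (ℕ.m+[n∸m]≡n j≤b))))) ⟩
  Σ≤ b (λ j → sgn b ((slice F j ⋆ slice G (b ∸ j)) m))
    ≡⟨ Σ≤-sgn b b _ ⟩
  sgn b ((F ⋆ G) (b ∷ m)) ∎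

Σ≤-negVar₀ : ∀ n (F : ℕ → Series) l → Σ≤ n (λ i → negVar₀ (F i) l) ≡ negVar₀ (λ u → Σ≤ n (λ i → F i u)) l
Σ≤-negVar₀ n F [] = refl
Σ≤-negVar₀ n F (b ∷ m) = Σ≤-sgn b n _

negVar₁-⋆ : ∀ F G → negVar₁ F ⋆ negVar₁ G ≗ negVar₁ (F ⋆ G)
negVar₁-⋆ F G [] = refl
negVar₁-⋆ F G (a ∷ l) =
  trans (Σ≤-cong a (λ i → negVar₀-⋆ (slice F i) (slice G (a ∸ i)) l)) (Σ≤-negVar₀ a _ l)

negVar₁-involutive : ∀ F → negVar₁ (negVar₁ F) ≗ F
negVar₁-involutive F [] = refl
negVar₁-involutive F (a ∷ []) = refl
negVar₁-involutive F (a ∷ b ∷ m) = sgn-involutive b _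

constIn₀ : Series → Series
constIn₀ F [] = F []
constIn₀ F (a ∷ l) = when (a ≡ᵇ 0) (F l)

constIn₀-cong : ∀ {F G} → F ≗ G → constIn₀ F ≗ constIn₀ G
constIn₀-cong e [] = e []
constIn₀-cong e (a ∷ l) = cong (when (a ≡ᵇ 0)) (e l)

constIn₀-⋆ : ∀ F G → constIn₀ F ⋆ constIn₀ G ≗ constIn₀ (F ⋆ G)
constIn₀-⋆ F G [] = refl
constIn₀-⋆ F G (zero ∷ l) = refl
constIn₀-⋆ F G (suc c ∷ l) =
  trans (Σ≤-suc-head c _) (trans (cong₂ _+_ (⋆-zeroʳ F l) (Σ≤-zero c (λ i → ⋆-zeroˡ _ l))) (ℚ.+-identityʳ 0ℚ))

constIn₀-𝟙 : constIn₀ 𝟙 ≗ 𝟙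
constIn₀-𝟙 [] = refl
constIn₀-𝟙 (zero ∷ l) = refl
constIn₀-𝟙 (suc a ∷ l) = refl

negVar₁-constIn₀ : ∀ F → negVar₁ (constIn₀ F) ≗ constIn₀ (negVar₀ F)
negVar₁-constIn₀ F [] = refl
negVar₁-constIn₀ F (a ∷ []) = refl
negVar₁-constIn₀ F (a ∷ b ∷ m) = sgn-when b (a ≡ᵇ 0) _

-- E(-t) H(t) = 1

eSeries hSeries : Series
eSeries [] = eCoeff 0 []
eSeries (b ∷ m) = eCoeff b m
hSeries [] = hCoeff 0 []
hSeries (b ∷ m) = hCoeff b m

asSeries-E : asSeries E ≗ constIn₀ eSeries
asSeries-E [] = refl
asSeries-E (a ∷ []) = if-then-0≡when (a ≡ᵇ 0) _
asSeries-E (a ∷ b ∷ m) = if-then-0≡when (a ≡ᵇ 0) _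

asSeries-H : asSeries H ≗ constIn₀ hSeries
asSeries-H [] = refl
asSeries-H (a ∷ []) = if-then-0≡when (a ≡ᵇ 0) _
asSeries-H (a ∷ b ∷ m) = if-then-0≡when (a ≡ᵇ 0) _

+≡ᵇ-split : ∀ i s j → (i +ℕ s ≡ᵇ j) ≡ ((i ≤ᵇ j) ∧ (s ≡ᵇ (j ∸ i)))
+≡ᵇ-split zero s j = refl
+≡ᵇ-split (suc i) s zero = refl
+≡ᵇ-split (suc i) s (suc j) rewrite suc≤ᵇsuc i j = +≡ᵇ-split i s j

eCoeff-∷ : ∀ n i u → eCoeff n (i ∷ u) ≡ when (i ≤ᵇ 1) (when (i ≤ᵇ n) (eCoeff (n ∸ i) u))
eCoeff-∷ n i u rewrite +≡ᵇ-split i (sum u) n = regroup (i ≤ᵇ 1) (all (λ c → c ≤ᵇ 1) u) (i ≤ᵇ n) (sum u ≡ᵇ (n ∸ i))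
  where
  regroup : ∀ p A q B → (if (p ∧ A) ∧ (q ∧ B) then 1ℚ else 0ℚ) ≡ when p (when q (if A ∧ B then 1ℚ else 0ℚ))
  regroup false A q B = refl
  regroup true A true B = refl
  regroup true true false B = refl
  regroup true false false B = refl

hCoeff-∷ : ∀ n i u → hCoeff n (i ∷ u) ≡ when (i ≤ᵇ n) (hCoeff (n ∸ i) u)
hCoeff-∷ n i u rewrite +≡ᵇ-split i (sum u) n = if-∧ (i ≤ᵇ n) (sum u ≡ᵇ (n ∸ i))
  where
  if-∧ : ∀ p B → (if p ∧ B then 1ℚ else 0ℚ) ≡ when p (if B then 1ℚ else 0ℚ)
  if-∧ false B = refl
  if-∧ true B = refl

eh : List ℕ → ℕ → ℕ → ℚ
eh l p q = (eCoeff p ⋆ hCoeff q) l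

eh-0∷ : ∀ m p q → eh (0 ∷ m) p q ≡ eh m p q
eh-0∷ m p q = ⋆-cong (eCoeff-∷ p 0) (hCoeff-∷ q 0) m

Σ≤-first-two : ∀ n (f : ℕ → ℚ) → (∀ i → f (suc (suc i)) ≡ 0ℚ) → Σ≤ (suc n) f ≡ f 0 + f 1
Σ≤-first-two n f f≡0 = trans (Σ≤-suc-head n f) (cong (f 0 +_) (tail-sum n))
  where
  tail-sum : ∀ n → Σ≤ n (λ i → f (suc i)) ≡ f 1
  tail-sum zero = refl
  tail-sum (suc n) = trans (Σ≤-suc-head n _) (trans (cong (f 1 +_) (Σ≤-zero n f≡0)) (ℚ.+-identityʳ _))

eh-∷ : ∀ c m p q →
  eh (c ∷ m) p q ≡ Σ≤ c (λ i → when (i ≤ᵇ 1) (when (i ≤ᵇ p) (when ((c ∸ i) ≤ᵇ q) (eh m (p ∸ i) (q ∸ (c ∸ i))))))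
eh-∷ c m p q = Σ≤-cong c (λ i → begin
  (slice (eCoeff p) i ⋆ slice (hCoeff q) (c ∸ i)) m
    ≡⟨ ⋆-cong (eCoeff-∷ p i) (hCoeff-∷ q (c ∸ i)) m ⟩
  ((λ u → when (i ≤ᵇ 1) (when (i ≤ᵇ p) (eCoeff (p ∸ i) u))) ⋆ (λ v → when ((c ∸ i) ≤ᵇ q) (hCoeff (q ∸ (c ∸ i)) v))) m
    ≡⟨ ⋆-whenˡ (i ≤ᵇ 1) _ _ m ⟩
  when (i ≤ᵇ 1) (((λ u → when (i ≤ᵇ p) (eCoeff (p ∸ i) u)) ⋆ (λ v → when ((c ∸ i) ≤ᵇ q) (hCoeff (q ∸ (c ∸ i)) v))) m)
    ≡⟨ cong (when (i ≤ᵇ 1)) (⋆-whenˡʳ (i ≤ᵇ p) ((c ∸ i) ≤ᵇ q) _ _ m) ⟩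
  when (i ≤ᵇ 1) (when (i ≤ᵇ p) (when ((c ∸ i) ≤ᵇ q) (eh m (p ∸ i) (q ∸ (c ∸ i))))) ∎)

-- Only the x₀-exponents 0 and 1 occur in e_p.
eh-suc∷ : ∀ c m p q →
  eh (suc c ∷ m) p q ≡ when (suc c ≤ᵇ q) (eh m p (q ∸ suc c)) + when (1 ≤ᵇ p) (when (c ≤ᵇ q) (eh m (p ∸ 1) (q ∸ c)))
eh-suc∷ c m p q = trans (eh-∷ (suc c) m p q) (Σ≤-first-two c _ (λ i → refl))

𝟙-∷-suc : ∀ a b m → 𝟙 (a ∷ suc b ∷ m) ≡ 0ℚ
𝟙-∷-suc zero b m = refl
𝟙-∷-suc (suc a) b m = refl

-- the coefficient of t^b x^l in E(-t) H(t)
alt : ℕ → List ℕ → ℚ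
alt b l = Σ≤ b (λ j → sgn j (eh l j (b ∸ j)))

alt-[] : ∀ b → alt b [] ≡ 𝟙 (b ∷ [])
alt-[] zero = ℚ.*-identityˡ 1ℚ
alt-[] (suc b) = begin
  Σ≤ (suc b) (λ j → sgn j (eCoeff j [] · hCoeff (suc b ∸ j) []))
    ≡⟨ Σ≤-suc-head b _ ⟩
  1ℚ · 0ℚ + Σ≤ b (λ j → sgn (suc j) (0ℚ · hCoeff (b ∸ j) []))
    ≡⟨ cong₂ _+_ (ℚ.*-zeroʳ 1ℚ) (Σ≤-zero b (λ j → trans (cong (sgn (suc j)) (ℚ.*-zeroˡ (hCoeff (b ∸ j) []))) (sgn-0 (suc j)))) ⟩
  0ℚ + 0ℚ ∎

alt-0∷ : ∀ b m → alt b (0 ∷ m) ≡ alt b m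
alt-0∷ b m = Σ≤-cong b (λ j → cong (sgn j) (eh-0∷ m j (b ∸ j)))

-- A positive exponent of x₀ makes the alternating sum telescope.
alt-suc∷ : ∀ b c m → alt b (suc c ∷ m) ≡ 0ℚ
alt-suc∷ zero c m = eh-suc∷ c m 0 0
alt-suc∷ (suc b) c m = begin
  Σ≤ (suc b) (λ j → sgn j (eh (suc c ∷ m) j (suc b ∸ j)))
    ≡⟨ Σ≤-cong (suc b) (λ j → trans (cong (sgn j) (eh-suc∷ c m j (suc b ∸ j))) (sgn-+ j _ _)) ⟩
  Σ≤ (suc b) (λ j → sgn j (x₀-from-h j) + sgn j (x₀-from-e j))
    ≡⟨ Σ≤-distrib-+ (suc b) _ _ ⟩
  Σ≤ (suc b) (λ j → sgn j (x₀-from-h j)) + Σ≤ (suc b) (λ j → sgn j (x₀-from-e j))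
    ≡⟨ cong₂ _+_ h-part e-part ⟩
  rest + - rest
    ≡⟨ ℚ.+-inverseʳ rest ⟩
  0ℚ ∎
  where
  x₀-from-h x₀-from-e : ℕ → ℚ
  x₀-from-h j = when (suc c ≤ᵇ (suc b ∸ j)) (eh m j ((suc b ∸ j) ∸ suc c))
  x₀-from-e j = when (1 ≤ᵇ j) (when (c ≤ᵇ (suc b ∸ j)) (eh m (j ∸ 1) ((suc b ∸ j) ∸ c)))
  rest : ℚ
  rest = Σ≤ b (λ j → sgn j (when (c ≤ᵇ (b ∸ j)) (eh m j ((b ∸ j) ∸ c))))
  h-term : ∀ j → j ≤ b → sgn j (x₀-from-h j) ≡ sgn j (when (c ≤ᵇ (b ∸ j)) (eh m j ((b ∸ j) ∸ c)))
  h-term j j≤b rewrite ℕ.+-∸-assoc 1 j≤b | suc≤ᵇsuc c (b ∸ j) = refl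
  h-last : x₀-from-h (suc b) ≡ 0ℚ
  h-last rewrite ℕ.n∸n≡0 b = refl
  h-part : Σ≤ (suc b) (λ j → sgn j (x₀-from-h j)) ≡ rest
  h-part = trans (cong₂ _+_ (Σ≤-cong-≤ b h-term) (trans (cong (sgn (suc b)) h-last) (sgn-0 (suc b)))) (ℚ.+-identityʳ rest)
  e-part : Σ≤ (suc b) (λ j → sgn j (x₀-from-e j)) ≡ - rest
  e-part = trans (Σ≤-suc-head b _) (trans (ℚ.+-identityˡ _) (Σ≤-neg b _))

alt≡𝟙 : ∀ l b → alt b l ≡ 𝟙 (b ∷ l)
alt≡𝟙 [] b = alt-[] b
alt≡𝟙 (zero ∷ m) b = trans (alt-0∷ b m) (alt≡𝟙 m b)
alt≡𝟙 (suc c ∷ m) b = trans (alt-suc∷ b c m) (sym (𝟙-∷-suc b c m))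

negVar₀-eSeries⋆hSeries : negVar₀ eSeries ⋆ hSeries ≗ 𝟙
negVar₀-eSeries⋆hSeries [] = ℚ.*-identityˡ 1ℚ
negVar₀-eSeries⋆hSeries (b ∷ l) = trans (Σ≤-cong b (λ j → ⋆-sgnˡ j _ _ l)) (alt≡𝟙 l b)

negVar₁-cong : ∀ {F G} → F ≗ G → negVar₁ F ≗ negVar₁ G
negVar₁-cong e [] = e []
negVar₁-cong e (a ∷ []) = e (a ∷ [])
negVar₁-cong e (a ∷ b ∷ m) = cong (sgn b) (e (a ∷ b ∷ m))

E[-t]⋆H≗𝟙 : negVar₁ (asSeries E) ⋆ asSeries H ≗ 𝟙
E[-t]⋆H≗𝟙 l = begin
  (negVar₁ (asSeries E) ⋆ asSeries H) l
    ≡⟨ ⋆-cong (λ l' → trans (negVar₁-cong asSeries-E l') (negVar₁-constIn₀ eSeries l')) asSeries-H l ⟩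
  (constIn₀ (negVar₀ eSeries) ⋆ constIn₀ hSeries) l
    ≡⟨ constIn₀-⋆ (negVar₀ eSeries) hSeries l ⟩
  constIn₀ (negVar₀ eSeries ⋆ hSeries) l
    ≡⟨ constIn₀-cong negVar₀-eSeries⋆hSeries l ⟩
  constIn₀ 𝟙 l
    ≡⟨ constIn₀-𝟙 l ⟩
  𝟙 l ∎

-- The substitution t ↦ q^k t

dilate : ℕ → Series → Series
dilate k F [] = F []
dilate k F (a ∷ []) = F (a ∷ [])
dilate k F (a ∷ b ∷ m) = when ((k *ℕ b) ≤ᵇ a) (F ((a ∸ (k *ℕ b)) ∷ b ∷ m))

dilate-cong : ∀ k {F G} → F ≗ G → dilate k F ≗ dilate k G
dilate-cong k e [] = e []
dilate-cong k e (a ∷ []) = e (a ∷ [])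
dilate-cong k e (a ∷ b ∷ m) = cong (when ((k *ℕ b) ≤ᵇ a)) (e _)

dilate-+ : ∀ k F G → dilate k (F +ₛ G) ≗ dilate k F +ₛ dilate k G
dilate-+ k F G [] = refl
dilate-+ k F G (a ∷ []) = refl
dilate-+ k F G (a ∷ b ∷ m) = when-+ ((k *ℕ b) ≤ᵇ a) _ _

dilate-zero : ∀ F → dilate 0 F ≗ F
dilate-zero F [] = refl
dilate-zero F (a ∷ []) = refl
dilate-zero F (a ∷ b ∷ m) = refl

dilate-dilate-one : ∀ k F → dilate k (dilate 1 F) ≗ dilate (suc k) F
dilate-dilate-one k F [] = refl
dilate-dilate-one k F (a ∷ []) = refl
dilate-dilate-one k F (a ∷ b ∷ m) rewrite ℕ.*-identityˡ b =
  trans (when-≤ᵇ-∸ (k *ℕ b) b a _)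
    (cong₂ (λ n r → when (n ≤ᵇ a) (F (r ∷ b ∷ m))) (ℕ.+-comm (k *ℕ b) b)
       (trans (ℕ.∸-+-assoc a (k *ℕ b) b) (cong (a ∸_) (ℕ.+-comm (k *ℕ b) b))))

dilate-⋆ : ∀ k F G → dilate k F ⋆ dilate k G ≗ dilate k (F ⋆ G)
dilate-⋆ k F G [] = refl
dilate-⋆ k F G (c ∷ []) = refl
dilate-⋆ k F G (a ∷ b ∷ m) = begin
  Σ≤ a (λ i → Σ≤ b (λ j → ((λ u → when ((k *ℕ j) ≤ᵇ i) (F ((i ∸ (k *ℕ j)) ∷ j ∷ u)))
                    ⋆ (λ v → when ((k *ℕ (b ∸ j)) ≤ᵇ (a ∸ i)) (G (((a ∸ i) ∸ (k *ℕ (b ∸ j))) ∷ (b ∸ j) ∷ v)))) m))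
    ≡⟨ Σ≤-cong a (λ i → Σ≤-cong b (λ j → ⋆-whenˡʳ ((k *ℕ j) ≤ᵇ i) ((k *ℕ (b ∸ j)) ≤ᵇ (a ∸ i)) _ _ m)) ⟩
  Σ≤ a (λ i → Σ≤ b (λ j → when ((k *ℕ j) ≤ᵇ i) (when ((k *ℕ (b ∸ j)) ≤ᵇ (a ∸ i))
                    (term j (i ∸ (k *ℕ j)) ((a ∸ i) ∸ (k *ℕ (b ∸ j)))))))
    ≡⟨ Σ≤-comm a b _ ⟩
  Σ≤ b (λ j → Σ≤ a (λ i → when ((k *ℕ j) ≤ᵇ i) (when ((k *ℕ (b ∸ j)) ≤ᵇ (a ∸ i))
                    (term j (i ∸ (k *ℕ j)) ((a ∸ i) ∸ (k *ℕ (b ∸ j)))))))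
    ≡⟨ Σ≤-cong-≤ b (λ j j≤b → trans (Σ≤-shifted-convolution a (k *ℕ j) (k *ℕ (b ∸ j)) (term j))
          (cong (λ n → when (n ≤ᵇ a) (Σ≤ (a ∸ n) (λ i → term j i ((a ∸ n) ∸ i)))) (degrees-add-up j≤b))) ⟩
  Σ≤ b (λ j → when ((k *ℕ b) ≤ᵇ a) (Σ≤ (a ∸ (k *ℕ b)) (λ i → term j i ((a ∸ (k *ℕ b)) ∸ i))))
    ≡⟨ Σ≤-when b ((k *ℕ b) ≤ᵇ a) _ ⟩
  when ((k *ℕ b) ≤ᵇ a) (Σ≤ b (λ j → Σ≤ (a ∸ (k *ℕ b)) (λ i → term j i ((a ∸ (k *ℕ b)) ∸ i))))
    ≡⟨ cong (when ((k *ℕ b) ≤ᵇ a)) (Σ≤-comm b (a ∸ (k *ℕ b)) _) ⟩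
  when ((k *ℕ b) ≤ᵇ a) (Σ≤ (a ∸ (k *ℕ b)) (λ i → Σ≤ b (λ j → term j i ((a ∸ (k *ℕ b)) ∸ i)))) ∎
  where
  term : ℕ → ℕ → ℕ → ℚ
  term j x y = (slice (slice F x) j ⋆ slice (slice G y) (b ∸ j)) m
  degrees-add-up : ∀ {j} → j ≤ b → k *ℕ j +ℕ k *ℕ (b ∸ j) ≡ k *ℕ b
  degrees-add-up {j} j≤b = trans (sym (ℕ.*-distribˡ-+ k j (b ∸ j))) (cong (k *ℕ_) (ℕ.m+[n∸m]≡n j≤b))

dilate-𝟙 : ∀ k → dilate k 𝟙 ≗ 𝟙
dilate-𝟙 k [] = refl
dilate-𝟙 k (a ∷ []) = refl
dilate-𝟙 k (a ∷ zero ∷ m) rewrite ℕ.*-zeroʳ k = refl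
dilate-𝟙 k (a ∷ suc b ∷ m) =
  trans (cong (when ((k *ℕ suc b) ≤ᵇ a)) (𝟙-∷-suc (a ∸ (k *ℕ suc b)) b m)) (trans (when-0 ((k *ℕ suc b) ≤ᵇ a)) (sym (𝟙-∷-suc a b m)))

mulQ : Series → Series
mulQ F [] = 0ℚ
mulQ F (a ∷ l) = when (1 ≤ᵇ a) (F ((a ∸ 1) ∷ l))

mulT : Series → Series
mulT F [] = 0ℚ
mulT F (a ∷ []) = 0ℚ
mulT F (a ∷ b ∷ m) = when (1 ≤ᵇ b) (F (a ∷ (b ∸ 1) ∷ m))

oneMinusQₛ : Series → Series
oneMinusQₛ F = F -ₛ mulQ F

mulQ-cong : ∀ {F G} → F ≗ G → mulQ F ≗ mulQ G
mulQ-cong e [] = refl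
mulQ-cong e (a ∷ l) = cong (when (1 ≤ᵇ a)) (e _)

mulT-cong : ∀ {F G} → F ≗ G → mulT F ≗ mulT G
mulT-cong e [] = refl
mulT-cong e (a ∷ []) = refl
mulT-cong e (a ∷ b ∷ m) = cong (when (1 ≤ᵇ b)) (e _)

oneMinusQₛ-cong : ∀ {F G} → F ≗ G → oneMinusQₛ F ≗ oneMinusQₛ G
oneMinusQₛ-cong e l = cong₂ _+_ (e l) (cong -_ (mulQ-cong e l))

mulQ-⋆ : ∀ F G → mulQ F ⋆ G ≗ mulQ (F ⋆ G)
mulQ-⋆ F G [] = ℚ.*-zeroˡ (G [])
mulQ-⋆ F G (a ∷ l) = begin
  Σ≤ a (λ i → ((λ u → when (1 ≤ᵇ i) (F ((i ∸ 1) ∷ u))) ⋆ slice G (a ∸ i)) l)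
    ≡⟨ Σ≤-cong a (λ i → ⋆-whenˡ (1 ≤ᵇ i) _ _ l) ⟩
  Σ≤ a (λ i → when (1 ≤ᵇ i) ((slice F (i ∸ 1) ⋆ slice G (a ∸ i)) l))
    ≡⟨ Σ≤-from a 1 _ ⟩
  when (1 ≤ᵇ a) (Σ≤ (a ∸ 1) (λ i → (slice F i ⋆ slice G (a ∸ suc i)) l))
    ≡⟨ cong (when (1 ≤ᵇ a)) (Σ≤-cong (a ∸ 1) (λ i → cong (λ n → (slice F i ⋆ slice G n) l) (sym (ℕ.∸-+-assoc a 1 i)))) ⟩
  when (1 ≤ᵇ a) (Σ≤ (a ∸ 1) (λ i → (slice F i ⋆ slice G ((a ∸ 1) ∸ i)) l)) ∎

mulT-⋆ : ∀ F G → mulT F ⋆ G ≗ mulT (F ⋆ G)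
mulT-⋆ F G [] = ℚ.*-zeroˡ (G [])
mulT-⋆ F G (a ∷ []) = Σ≤-zero a (λ i → ℚ.*-zeroˡ (G ((a ∸ i) ∷ [])))
mulT-⋆ F G (a ∷ b ∷ m) =
  trans (Σ≤-cong a (λ i → mulQ-⋆ (slice F i) (slice G (a ∸ i)) (b ∷ m))) (Σ≤-when a (1 ≤ᵇ b) _)

oneMinusQₛ-⋆ : ∀ F G → oneMinusQₛ F ⋆ G ≗ oneMinusQₛ (F ⋆ G)
oneMinusQₛ-⋆ F G l = trans (⋆-distribʳ-sub F (mulQ F) G l) (cong (λ x → (F ⋆ G) l + - x) (mulQ-⋆ F G l))

-- (1 - q) involves no t, so it is fixed by the dilations.
dilate-oneMinusQₛ : ∀ k F → dilate k (oneMinusQₛ F) ≗ oneMinusQₛ (dilate k F)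
dilate-oneMinusQₛ k F l = begin
  dilate k (oneMinusQₛ F) l            ≡⟨ dilate-cong k as-product l ⟩
  dilate k (oneMinusQₛ 𝟙 ⋆ F) l        ≡⟨ dilate-⋆ k (oneMinusQₛ 𝟙) F l ⟨
  (dilate k (oneMinusQₛ 𝟙) ⋆ dilate k F) l ≡⟨ ⋆-congˡ (dilate k F) dilate-oneMinusQ l ⟩
  (oneMinusQₛ 𝟙 ⋆ dilate k F) l        ≡⟨ as-product l ⟨
  oneMinusQₛ (dilate k F) l ∎
  where
  as-product : ∀ {G} → oneMinusQₛ G ≗ oneMinusQₛ 𝟙 ⋆ G
  as-product {G} l = sym (trans (oneMinusQₛ-⋆ 𝟙 G l) (oneMinusQₛ-cong (⋆-identityˡ G) l))
  oneMinusQ-∷-suc : ∀ a b m → oneMinusQₛ 𝟙 (a ∷ suc b ∷ m) ≡ 0ℚ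
  oneMinusQ-∷-suc a b m =
    cong₂ _+_ (𝟙-∷-suc a b m) (cong -_ (trans (cong (when (1 ≤ᵇ a)) (𝟙-∷-suc (a ∸ 1) b m)) (when-0 (1 ≤ᵇ a))))
  dilate-oneMinusQ : dilate k (oneMinusQₛ 𝟙) ≗ oneMinusQₛ 𝟙
  dilate-oneMinusQ [] = refl
  dilate-oneMinusQ (a ∷ []) = refl
  dilate-oneMinusQ (a ∷ zero ∷ m) rewrite ℕ.*-zeroʳ k = refl
  dilate-oneMinusQ (a ∷ suc b ∷ m) =
    trans (cong (when ((k *ℕ suc b) ≤ᵇ a)) (oneMinusQ-∷-suc (a ∸ (k *ℕ suc b)) b m))
          (trans (when-0 ((k *ℕ suc b) ≤ᵇ a)) (sym (oneMinusQ-∷-suc a b m)))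

-- (1 - q) t D_q E(-t) = E(-qt) - E(-t)

when-≤ᵇ-∸≡ᵇ0 : ∀ a n x → when (n ≤ᵇ a) (when ((a ∸ n) ≡ᵇ 0) x) ≡ when (a ≡ᵇ n) x
when-≤ᵇ-∸≡ᵇ0 zero zero x = refl
when-≤ᵇ-∸≡ᵇ0 zero (suc n) x = refl
when-≤ᵇ-∸≡ᵇ0 (suc a) zero x = refl
when-≤ᵇ-∸≡ᵇ0 (suc a) (suc n) x rewrite suc≤ᵇsuc n a = when-≤ᵇ-∸≡ᵇ0 a n x

Σ≤-indicator : ∀ n a x → Σ≤ n (λ j → when (a ≡ᵇ j) x) ≡ when (a ≤ᵇ n) x
Σ≤-indicator zero zero x = refl
Σ≤-indicator zero (suc a) x = refl
Σ≤-indicator (suc n) zero x = trans (Σ≤-suc-head n _) (trans (cong (x +_) (Σ≤-zero n (λ _ → refl))) (ℚ.+-identityʳ x))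
Σ≤-indicator (suc n) (suc a) x rewrite suc≤ᵇsuc a n =
  trans (Σ≤-suc-head n _) (trans (ℚ.+-identityˡ _) (Σ≤-indicator n a x))

Dq-E : ∀ a b m → Dq E a b m ≡ when (a ≤ᵇ b) (eCoeff (suc b) m)
Dq-E a b m = trans (Σ≤-cong b only-j≡a) (Σ≤-indicator b a _)
  where
  only-j≡a : ∀ j → (if j ≤ᵇ a then E (a ∸ j) (suc b) m else 0ℚ) ≡ when (a ≡ᵇ j) (eCoeff (suc b) m)
  only-j≡a j = begin
    (if j ≤ᵇ a then E (a ∸ j) (suc b) m else 0ℚ)
      ≡⟨ if-then-0≡when (j ≤ᵇ a) _ ⟩
    when (j ≤ᵇ a) (E (a ∸ j) (suc b) m)
      ≡⟨ cong (when (j ≤ᵇ a)) (if-then-0≡when ((a ∸ j) ≡ᵇ 0) _) ⟩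
    when (j ≤ᵇ a) (when ((a ∸ j) ≡ᵇ 0) (eCoeff (suc b) m))
      ≡⟨ when-≤ᵇ-∸≡ᵇ0 a j _ ⟩
    when (a ≡ᵇ j) (eCoeff (suc b) m) ∎

-- The coefficient of q^a in (1 - q) [B + 1]_q = 1 - q^(B + 1).
oneMinusQ-qInteger : ∀ a B s →
  when (a ≤ᵇ B) s + - when (1 ≤ᵇ a) (when ((a ∸ 1) ≤ᵇ B) s) ≡ when (a ≡ᵇ 0) s + - when (a ≡ᵇ suc B) s
oneMinusQ-qInteger zero B s = refl
oneMinusQ-qInteger (suc a) B s = difference a B
  where
  difference : ∀ a B → when (suc a ≤ᵇ B) s + - when (a ≤ᵇ B) s ≡ 0ℚ + - when (a ≡ᵇ B) s
  difference zero zero = refl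
  difference zero (suc B) = ℚ.+-inverseʳ s
  difference (suc a) zero = refl
  difference (suc a) (suc B) rewrite suc≤ᵇsuc (suc a) B | suc≤ᵇsuc a B = difference a B

E[-t] : Series
E[-t] = negVar₁ (asSeries E)

E[-t]-suc : ∀ a B m → E[-t] (a ∷ suc B ∷ m) ≡ when (a ≡ᵇ 0) (sgn (suc B) (eCoeff (suc B) m))
E[-t]-suc a B m = trans (cong (sgn (suc B)) (if-then-0≡when (a ≡ᵇ 0) _)) (sgn-when (suc B) (a ≡ᵇ 0) _)

oneMinusQ-t-DqE[-t] : oneMinusQₛ (mulT (negVar₁ (asSeries (Dq E)))) ≗ dilate 1 E[-t] -ₛ E[-t]
oneMinusQ-t-DqE[-t] [] = sym (ℚ.+-inverseʳ (E[-t] []))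
oneMinusQ-t-DqE[-t] (a ∷ []) = trans (cong (λ z → 0ℚ + - z) (when-0 (1 ≤ᵇ a))) (sym (ℚ.+-inverseʳ (E[-t] (a ∷ []))))
oneMinusQ-t-DqE[-t] (a ∷ zero ∷ m) =
  trans (cong (λ z → 0ℚ + - z) (when-0 (1 ≤ᵇ a))) (sym (ℚ.+-inverseʳ (E[-t] (a ∷ 0 ∷ m))))
oneMinusQ-t-DqE[-t] (a ∷ suc B ∷ m) = begin
  sgn B (Dq E a B m) + - when (1 ≤ᵇ a) (sgn B (Dq E (a ∸ 1) B m))
    ≡⟨ cong₂ (λ x y → sgn B x + - when (1 ≤ᵇ a) (sgn B y)) (Dq-E a B m) (Dq-E (a ∸ 1) B m) ⟩
  sgn B (when (a ≤ᵇ B) e) + - when (1 ≤ᵇ a) (sgn B (when ((a ∸ 1) ≤ᵇ B) e))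
    ≡⟨ cong₂ (λ x y → x + - when (1 ≤ᵇ a) y) (sgn-when B (a ≤ᵇ B) e) (sgn-when B ((a ∸ 1) ≤ᵇ B) e) ⟩
  when (a ≤ᵇ B) s + - when (1 ≤ᵇ a) (when ((a ∸ 1) ≤ᵇ B) s)
    ≡⟨ oneMinusQ-qInteger a B s ⟩
  when (a ≡ᵇ 0) s + - when (a ≡ᵇ suc B) s
    ≡⟨ ℚ.+-comm (when (a ≡ᵇ 0) s) _ ⟩
  - when (a ≡ᵇ suc B) s + when (a ≡ᵇ 0) s
    ≡⟨ cong₂ _+_ (when-neg (a ≡ᵇ suc B) s) (trans (cong (when (a ≡ᵇ 0)) (sym (neg-involutive s))) (sym (when-neg (a ≡ᵇ 0) (- s)))) ⟩
  when (a ≡ᵇ suc B) (- s) + - when (a ≡ᵇ 0) (- s)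
    ≡⟨ cong (_+ - when (a ≡ᵇ 0) (- s)) (sym (when-≤ᵇ-∸≡ᵇ0 a (suc B) (- s))) ⟩
  when (suc B ≤ᵇ a) (when ((a ∸ suc B) ≡ᵇ 0) (- s)) + - when (a ≡ᵇ 0) (- s)
    ≡⟨ cong₂ (λ x y → when (suc B ≤ᵇ a) x + - y) (sym (E[-t]-suc (a ∸ suc B) B m)) (sym (E[-t]-suc a B m)) ⟩
  when (suc B ≤ᵇ a) (E[-t] ((a ∸ suc B) ∷ suc B ∷ m)) + - E[-t] (a ∷ suc B ∷ m)
    ≡⟨ cong (λ n → when (n ≤ᵇ a) (E[-t] ((a ∸ n) ∷ suc B ∷ m)) + - E[-t] (a ∷ suc B ∷ m)) (sym (ℕ.*-identityˡ (suc B))) ⟩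
  dilate 1 E[-t] (a ∷ suc B ∷ m) + - E[-t] (a ∷ suc B ∷ m) ∎
  where
  e s : ℚ
  e = eCoeff (suc B) m
  s = sgn B e

asSeries-negT : ∀ A → asSeries (negT A) ≗ negVar₁ (asSeries A)
asSeries-negT A [] = refl
asSeries-negT A (a ∷ []) = refl
asSeries-negT A (a ∷ b ∷ m) = refl

when-≤ᵇ-< : ∀ {i n} x → i < n → when (n ≤ᵇ i) x ≡ 0ℚ
when-≤ᵇ-< {zero} {suc n} x _ = refl
when-≤ᵇ-< {suc i} {suc n} x (s≤s i<n) rewrite suc≤ᵇsuc n i = when-≤ᵇ-< x i<n

sum≡ᵇ0 : ∀ m → (sum m ≡ᵇ 0) ≡ isZeroMono m
sum≡ᵇ0 [] = refl
sum≡ᵇ0 (zero ∷ m) = sum≡ᵇ0 m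
sum≡ᵇ0 (suc c ∷ m) = refl

dilate-H-low : ∀ K i → i < K → ∀ u → dilate K (asSeries H) (i ∷ u) ≡ 𝟙 (i ∷ u)
dilate-H-low K zero i<K [] = refl
dilate-H-low K (suc i) i<K [] = refl
dilate-H-low K zero i<K (zero ∷ m) rewrite ℕ.*-zeroʳ K = cong (λ b → if b then 1ℚ else 0ℚ) (sum≡ᵇ0 m)
dilate-H-low K (suc i) i<K (zero ∷ m) rewrite ℕ.*-zeroʳ K = refl
dilate-H-low K i i<K (suc b ∷ m) =
  trans (when-≤ᵇ-< _ (ℕ.<-≤-trans i<K (ℕ.m≤m*n K (suc b)))) (sym (𝟙-∷-suc i b m))

⋆-cong-below : ∀ F G G' a l → (∀ i → i ≤ a → ∀ u → G (i ∷ u) ≡ G' (i ∷ u)) → (F ⋆ G) (a ∷ l) ≡ (F ⋆ G') (a ∷ l)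
⋆-cong-below F G G' a l e = Σ≤-cong a (λ i → ⋆-congʳ (slice F i) (e (a ∸ i) (ℕ.m∸n≤m a i)) l)

qkt≡dilate-mulT : ∀ k A a b m → qkt k A a b m ≡ dilate k (mulT (asSeries A)) (a ∷ b ∷ m)
qkt≡dilate-mulT k A a zero m = sym (when-0 ((k *ℕ 0) ≤ᵇ a))
qkt≡dilate-mulT k A a (suc b) m = if-then-0≡when ((k *ℕ suc b) ≤ᵇ a) _

asSeries-factor : ∀ A k → asSeries (factor A k) ≗ 𝟙 +ₛ oneMinusQₛ (dilate k (mulT (asSeries A)))
asSeries-factor A k [] = refl
asSeries-factor A k (zero ∷ []) = refl
asSeries-factor A k (suc a ∷ []) = refl
asSeries-factor A k (zero ∷ b ∷ m) =
  cong (one 0 b m +_) (trans (qkt≡dilate-mulT k A 0 b m) (sym (ℚ.+-identityʳ _)))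
asSeries-factor A k (suc a ∷ b ∷ m) =
  cong (one (suc a) b m +_) (cong₂ (λ x y → x + - y) (qkt≡dilate-mulT k A (suc a) b m) (qkt≡dilate-mulT k A a b m))

module Factorisation (pq : PS) (hyp : ∀ (a b : ℕ) (m : List ℕ) → (negT pq ⊛ E) a b m ≡ Dq E a b m) where

  P Hₛ : Series
  P = asSeries pq
  Hₛ = asSeries H

  P≗DqE[-t]⋆H : P ≗ negVar₁ (asSeries (Dq E)) ⋆ Hₛ
  P≗DqE[-t]⋆H l = begin
    P l                                             ≡⟨ ⋆-identityʳ P l ⟨
    (P ⋆ 𝟙) l                                       ≡⟨ ⋆-congʳ P E[-t]⋆H≗𝟙 l ⟨
    (P ⋆ (E[-t] ⋆ Hₛ)) l                            ≡⟨ ⋆-assoc P E[-t] Hₛ l ⟨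
    ((P ⋆ E[-t]) ⋆ Hₛ) l                            ≡⟨ ⋆-congˡ Hₛ P⋆E[-t] l ⟩
    (negVar₁ (asSeries (Dq E)) ⋆ Hₛ) l ∎
    where
    hyp-series : negVar₁ P ⋆ asSeries E ≗ asSeries (Dq E)
    hyp-series l = trans (sym (⋆-congˡ (asSeries E) (asSeries-negT pq) l))
                         (trans (sym (asSeries-⊛ (negT pq) E l)) (asSeries-cong hyp l))
    P⋆E[-t] : P ⋆ E[-t] ≗ negVar₁ (asSeries (Dq E))
    P⋆E[-t] l = begin
      (P ⋆ E[-t]) l                         ≡⟨ ⋆-congˡ E[-t] (negVar₁-involutive P) l ⟨
      (negVar₁ (negVar₁ P) ⋆ E[-t]) l       ≡⟨ negVar₁-⋆ (negVar₁ P) (asSeries E) l ⟩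
      negVar₁ (negVar₁ P ⋆ asSeries E) l    ≡⟨ negVar₁-cong hyp-series l ⟩
      negVar₁ (asSeries (Dq E)) l ∎

  factor-identity : (𝟙 +ₛ oneMinusQₛ (mulT P)) ⋆ dilate 1 Hₛ ≗ Hₛ
  factor-identity l = begin
    ((𝟙 +ₛ oneMinusQₛ (mulT P)) ⋆ dilate 1 Hₛ) l
      ≡⟨ ⋆-distribʳ-+ 𝟙 _ (dilate 1 Hₛ) l ⟩
    (𝟙 ⋆ dilate 1 Hₛ) l + (oneMinusQₛ (mulT P) ⋆ dilate 1 Hₛ) l
      ≡⟨ cong₂ _+_ (⋆-identityˡ (dilate 1 Hₛ) l) (⋆-congˡ (dilate 1 Hₛ) (oneMinusQ-tP) l) ⟩
    dilate 1 Hₛ l + ((dilate 1 E[-t] ⋆ Hₛ -ₛ E[-t] ⋆ Hₛ) ⋆ dilate 1 Hₛ) l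
      ≡⟨ cong (dilate 1 Hₛ l +_) (trans (⋆-distribʳ-sub (dilate 1 E[-t] ⋆ Hₛ) (E[-t] ⋆ Hₛ) (dilate 1 Hₛ) l)
           (cong₂ (λ x y → x + - y) dilated-inverse (trans (⋆-congˡ (dilate 1 Hₛ) E[-t]⋆H≗𝟙 l) (⋆-identityˡ _ l)))) ⟩
    dilate 1 Hₛ l + (Hₛ l + - dilate 1 Hₛ l)
      ≡⟨ cong (dilate 1 Hₛ l +_) (ℚ.+-comm (Hₛ l) _) ⟩
    dilate 1 Hₛ l + (- dilate 1 Hₛ l + Hₛ l)
      ≡⟨ trans (sym (ℚ.+-assoc (dilate 1 Hₛ l) _ _)) (cong (_+ Hₛ l) (ℚ.+-inverseʳ (dilate 1 Hₛ l))) ⟩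
    0ℚ + Hₛ l
      ≡⟨ ℚ.+-identityˡ (Hₛ l) ⟩
    Hₛ l ∎
    where
    oneMinusQ-tP : oneMinusQₛ (mulT P) ≗ dilate 1 E[-t] ⋆ Hₛ -ₛ E[-t] ⋆ Hₛ
    oneMinusQ-tP l = begin
      oneMinusQₛ (mulT P) l                                          ≡⟨ oneMinusQₛ-cong (mulT-cong P≗DqE[-t]⋆H) l ⟩
      oneMinusQₛ (mulT (negVar₁ (asSeries (Dq E)) ⋆ Hₛ)) l           ≡⟨ oneMinusQₛ-cong (λ l' → sym (mulT-⋆ _ Hₛ l')) l ⟩
      oneMinusQₛ (mulT (negVar₁ (asSeries (Dq E))) ⋆ Hₛ) l           ≡⟨ oneMinusQₛ-⋆ _ Hₛ l ⟨
      (oneMinusQₛ (mulT (negVar₁ (asSeries (Dq E)))) ⋆ Hₛ) l         ≡⟨ ⋆-congˡ Hₛ oneMinusQ-t-DqE[-t] l ⟩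
      ((dilate 1 E[-t] -ₛ E[-t]) ⋆ Hₛ) l                           ≡⟨ ⋆-distribʳ-sub (dilate 1 E[-t]) E[-t] Hₛ l ⟩
      (dilate 1 E[-t] ⋆ Hₛ -ₛ E[-t] ⋆ Hₛ) l ∎
    dilated-inverse : ((dilate 1 E[-t] ⋆ Hₛ) ⋆ dilate 1 Hₛ) l ≡ Hₛ l
    dilated-inverse = begin
      ((dilate 1 E[-t] ⋆ Hₛ) ⋆ dilate 1 Hₛ) l      ≡⟨ ⋆-congˡ (dilate 1 Hₛ) (⋆-comm (dilate 1 E[-t]) Hₛ) l ⟩
      ((Hₛ ⋆ dilate 1 E[-t]) ⋆ dilate 1 Hₛ) l      ≡⟨ ⋆-assoc Hₛ (dilate 1 E[-t]) (dilate 1 Hₛ) l ⟩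
      (Hₛ ⋆ (dilate 1 E[-t] ⋆ dilate 1 Hₛ)) l      ≡⟨ ⋆-congʳ Hₛ (dilate-⋆ 1 E[-t] Hₛ) l ⟩
      (Hₛ ⋆ dilate 1 (E[-t] ⋆ Hₛ)) l               ≡⟨ ⋆-congʳ Hₛ (λ l' → trans (dilate-cong 1 E[-t]⋆H≗𝟙 l') (dilate-𝟙 1 l')) l ⟩
      (Hₛ ⋆ 𝟙) l                                   ≡⟨ ⋆-identityʳ Hₛ l ⟩
      Hₛ l ∎

  factor-identity-dilated : ∀ k → asSeries (factor pq k) ⋆ dilate (suc k) Hₛ ≗ dilate k Hₛ
  factor-identity-dilated k l = begin
    (asSeries (factor pq k) ⋆ dilate (suc k) Hₛ) l
      ≡⟨ ⋆-cong (asSeries-factor pq k) (λ l' → sym (dilate-dilate-one k Hₛ l')) l ⟩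
    ((𝟙 +ₛ oneMinusQₛ (dilate k (mulT P))) ⋆ dilate k (dilate 1 Hₛ)) l
      ≡⟨ ⋆-congˡ _ (λ l' → sym (trans (dilate-+ k 𝟙 _ l') (cong₂ _+_ (dilate-𝟙 k l') (dilate-oneMinusQₛ k (mulT P) l')))) l ⟩
    (dilate k (𝟙 +ₛ oneMinusQₛ (mulT P)) ⋆ dilate k (dilate 1 Hₛ)) l
      ≡⟨ dilate-⋆ k _ _ l ⟩
    dilate k ((𝟙 +ₛ oneMinusQₛ (mulT P)) ⋆ dilate 1 Hₛ) l
      ≡⟨ dilate-cong k factor-identity l ⟩
    dilate k Hₛ l ∎

  partialProd-telescopes : ∀ K → asSeries (partialProd pq K) ⋆ dilate K Hₛ ≗ Hₛ
  partialProd-telescopes zero l = trans (⋆-cong asSeries-one (dilate-zero Hₛ) l) (⋆-identityˡ Hₛ l)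
  partialProd-telescopes (suc K) l = begin
    (asSeries (partialProd pq K ⊛ factor pq K) ⋆ dilate (suc K) Hₛ) l
      ≡⟨ ⋆-congˡ _ (asSeries-⊛ (partialProd pq K) (factor pq K)) l ⟩
    ((asSeries (partialProd pq K) ⋆ asSeries (factor pq K)) ⋆ dilate (suc K) Hₛ) l
      ≡⟨ ⋆-assoc (asSeries (partialProd pq K)) _ _ l ⟩
    (asSeries (partialProd pq K) ⋆ (asSeries (factor pq K) ⋆ dilate (suc K) Hₛ)) l
      ≡⟨ ⋆-congʳ (asSeries (partialProd pq K)) (factor-identity-dilated K) l ⟩
    (asSeries (partialProd pq K) ⋆ dilate K Hₛ) l
      ≡⟨ partialProd-telescopes K l ⟩
    Hₛ l ∎

  partialProd-stabilises : ∀ a b K → suc a ≤ K → ∀ m → partialProd pq K a b m ≡ H a b m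
  partialProd-stabilises a b K a<K m = begin
    partialProd pq K a b m
      ≡⟨ ⋆-identityʳ (asSeries (partialProd pq K)) (a ∷ b ∷ m) ⟨
    (asSeries (partialProd pq K) ⋆ 𝟙) (a ∷ b ∷ m)
      ≡⟨ ⋆-cong-below (asSeries (partialProd pq K)) 𝟙 (dilate K Hₛ) a (b ∷ m)
           (λ i i≤a u → sym (dilate-H-low K i (ℕ.<-≤-trans (s≤s i≤a) a<K) u)) ⟩
    (asSeries (partialProd pq K) ⋆ dilate K Hₛ) (a ∷ b ∷ m)
      ≡⟨ partialProd-telescopes K (a ∷ b ∷ m) ⟩
    H a b m ∎

corollary8p5 : (pq : PS) →
    (∀ (a b : ℕ) (m : List ℕ) → (negT pq ⊛ E) a b m ≡ Dq E a b m) →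
    ∀ (a b : ℕ) → ∃[ K₀ ] (∀ (K : ℕ) → K₀ ≤ K → ∀ (m : List ℕ) → partialProd pq K a b m ≡ H a b m)
corollary8p5 pq hyp a b = suc a , Factorisation.partialProd-stabilises pq hyp a b
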